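{- Let $\Gamma$ be a typing context and $P$ a process. If $\Gamma\vdash P$ and $\mathsf{un}(\Gamma)$, then $P$ is safe.
   Context: The setting is a synchronous session-typed $\pi$-calculus with assume/assert and linear refinements. Syntax. Values: $v ::= x \mid ()$. Formulae: $\varphi ::= A(v_1,\dots,v_n) \mid \varphi\otimes\varphi \mid \mathbf 1$, with $A$ ranging over uninterpreted predicate symbols; formulae $A(v_1,\dots,v_n)$ are atomic. Processes: $P ::= x\langle v\rangle.P \mid x(y).P \mid P\mid P \mid {*}P \mid \mathbf 0 \mid (\nu xy\colon T)P \mid (\mathsf{assume}\ \varphi)P \mid \mathsf{assert}\ \varphi.P$. Qualifiers $q::=\mathsf{lin}\mid\mathsf{un}$; session types $p ::= ?x\colon T.T \mid !x\colon T.T$; types $T ::= \mathsf{unit}\mid\mathsf{end}\mid q\,p\mid \{x\colon T\mid\varphi\}\mid\alpha\mid\mu\alpha.T$ (contractive, and no subterm $\mu\alpha_1\dots\mu\alpha_n.\{x\colon T\mid\varphi\}$). Contexts: $\Gamma ::= \cdot \mid \Gamma,x\colon T\mid \Gamma,\varphi$ (ordered); $\operatorname{dom}(\Gamma)=\{x\mid x\colon T\in\Gamma\}$. Binders: $y$ in $x(y).P$; $x,y$ in $(\nu xy\colon T)P$; $y$ in $U$ within $q?y\colon T.U$, $q!y\colon T.U$; $x$ in $\varphi$ within $\{x\colon T\mid\varphi\}$; $\alpha$ in $\mu\alpha.T$. $\mathrm{fv}$ = free variables; $\{v/x\}$ = capture-avoiding substitution. Alpha-conversion and Barendregt's variable convention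 are assumed; the usual side conditions on bound variables are left implicit and taken to be guaranteed by this convention. Equivalence: on formulae the smallest equivalence with $\varphi_1\otimes\varphi_2\equiv\varphi_2\otimes\varphi_1$, $\varphi\otimes\mathbf 1\equiv\varphi$; on types a coinductive equivalence identifying $\mu\alpha.T$ with $T\{\mu\alpha.T/\alpha\}$ and refinement types differing only in equivalent formulae. Heating $P\Rrightarrow Q$ ($P\equiv Q$ meaning both directions), generated (reflexive, transitive, closed under process constructors as is standard) by: $P\mid Q\equiv Q\mid P$; $(P\mid Q)\mid R\equiv P\mid(Q\mid R)$; $P\mid\mathbf 0\equiv P$; ${*}P\equiv P\mid{*}P$; $(\nu xy\colon T)\mathbf 0\equiv\mathbf 0$; $(\nu xy\colon T)(P\mid Q)\equiv(\nu xy\colon T)P\mid Q$; $(\nu wz\colon T)(\nu xy\colon U)P\equiv(\nu xy\colon U)(\nu wz\colon T)P$; $(\nu xy\colon T)(\mathsf{assume}\ \varphi)P\equiv(\mathsf{assume}\ \varphi)(\nu xy\colon T)P$; $(\mathsf{assume}\ \mathbf 1)P\equiv P$; $\mathsf{assert}\ \mathbf 1.P\equiv P$; $(\mathsf{assume}\ \varphi_1)(\mathsf{assume}\ \varphi_2)P\equiv(\mathsf{assume}\ \varphi_2)(\mathsf{assume}\ \varphi_1)P$; $\mathsf{assert}\ \varphi_1.\mathsf{assert}\ \varphi_2.P\equiv\mathsf{assert}\ \varphi_2.\mathsf{assert}\ \varphi_1.P$; $\mathsf{assert}\ \varphi_1\otimes\varphi_2.P\equiv\mathsf{assert}\ \varphi_1.\mathsf{assert}\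 \varphi_2.P$; $(\mathsf{assume}\ \varphi_1\otimes\varphi_2)P\equiv(\mathsf{assume}\ \varphi_1)(\mathsf{assume}\ \varphi_2)P$; $(\mathsf{assume}\ \varphi)P\mid Q\Rrightarrow(\mathsf{assume}\ \varphi)(P\mid Q)$ (one direction only); $(\nu xy\colon T)P\equiv(\nu xy\colon U)P$ if $T\equiv U$. Safety. A process is in canonical form if it is $(\nu x_1y_1\colon T_1)\cdots(\nu x_ky_k\colon T_k)(\mathsf{assume}\ A_1)\cdots(\mathsf{assume}\ A_m)(P_1\mid\cdots\mid P_n)$ with $k,m\ge 0$, $n>0$, the $A_j$ atomic formulae, and each $P_i$ neither a restriction, nor an assume, nor a parallel composition. A process $Q$ is safe if for every process $P$ in canonical form (as displayed) with $Q\Rrightarrow P$, and every $i$ such that $P_i$ has the form $\mathsf{assert}\ B_i.R_i$ with $B_i$ atomic, there is $1\le j\le m$ with $B_i=A_j$. Duality: $\overline{q?x\colon T.U}=q!x\colon T.\overline U$, $\overline{q!x\colon T.U}=q?x\colon T.\overline U$, $\overline{\mathsf{end}}=\mathsf{end}$, $\overline{\mu\alpha.T}=\mu\alpha.\overline T$, $\overline\alpha=\alpha$. Unrestricted: $\mathsf{un}(\mathsf{unit})$, $\mathsf{un}(\mathsf{end})$, $\mathsf{un}(\mathsf{un}\,p)$; $\mathsf{un}(\cdot)$, $\mathsf{un}(\Gamma,x\colon T)$ if $\mathsf{un}(\Gamma)$ and $\mathsf{un}(T)$ (so unrestricted contexts contain no formulae). Well-formedness: $\Gamma\vdash_{wf}\varphi$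 iff $\mathrm{fv}(\varphi)\subseteq\operatorname{dom}(\Gamma)$; $\Gamma\vdash_{wf}T$ iff $\mathrm{fv}(T)\subseteq\operatorname{dom}(\Gamma)$; $\vdash_{wf}\cdot$; $\vdash_{wf}\Gamma,x\colon T$ if $\vdash_{wf}\Gamma$, $\Gamma\vdash_{wf}T$; $\vdash_{wf}\Gamma,\varphi$ if $\vdash_{wf}\Gamma$, $\Gamma\vdash_{wf}\varphi$. Context split $\Gamma=\Gamma_1\circ\Gamma_2$: $\cdot=\cdot\circ\cdot$; $\Gamma,x\colon\mathsf{lin}\,p=(\Gamma_1,x\colon\mathsf{lin}\,p)\circ\Gamma_2$ if $\Gamma=\Gamma_1\circ\Gamma_2$, $\Gamma_1\vdash_{wf}\mathsf{lin}\,p$ (and symmetrically into $\Gamma_2$ if $\Gamma_2\vdash_{wf}\mathsf{lin}\,p$); $\Gamma,x\colon T=(\Gamma_1,x\colon T)\circ(\Gamma_2,x\colon T)$ if $\Gamma=\Gamma_1\circ\Gamma_2$, $\mathsf{un}(T)$; $\Gamma,\varphi=(\Gamma_1,\varphi)\circ\Gamma_2$ if $\Gamma=\Gamma_1\circ\Gamma_2$, $\Gamma_1\vdash_{wf}\varphi$ (and symmetrically into $\Gamma_2$). Context update: $\Gamma+x\colon T=\Gamma,x\colon T$ if $x\notin\operatorname{dom}(\Gamma)$, $\Gamma\vdash_{wf}T$; $(\Gamma,x\colon T)+x\colon T=(\Gamma,x\colon T)$ if $\mathsf{un}(T)$. Typing (a context $\Gamma_1\circ\Gamma_2$ in a rule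 stands for any $\Gamma$ with $\Gamma=\Gamma_1\circ\Gamma_2$). Formulae: $\Gamma\vdash\mathbf 1$ if $\vdash_{wf}\Gamma$, $\mathsf{un}(\Gamma)$; $\Gamma_1,\varphi,\Gamma_2\vdash\varphi$ if $\vdash_{wf}\Gamma_1,\varphi,\Gamma_2$, $\mathsf{un}(\Gamma_1,\Gamma_2)$; $\Gamma_1\circ\Gamma_2\vdash\varphi_1\otimes\varphi_2$ if $\Gamma_i\vdash\varphi_i$. Values: $\Gamma\vdash()\colon\mathsf{unit}$ if $\vdash_{wf}\Gamma$, $\mathsf{un}(\Gamma)$; $\Gamma_1,x\colon T,\Gamma_2\vdash x\colon T$ if $\vdash_{wf}\Gamma_1,x\colon T,\Gamma_2$, $\mathsf{un}(\Gamma_1,\Gamma_2)$; $\Gamma_1\circ\Gamma_2\vdash v\colon\{x\colon T\mid\varphi\}$ if $\Gamma_1\vdash\varphi\{v/x\}$, $\Gamma_2\vdash v\colon T$; $\Gamma\vdash v\colon T_2$ if $\Gamma\vdash v\colon T_1$, $T_1\equiv T_2$. Processes: $\Gamma\vdash\mathbf 0$ if $\vdash_{wf}\Gamma$, $\mathsf{un}(\Gamma)$; $\Gamma_1\circ\Gamma_2\vdash P_1\mid P_2$ if $\Gamma_i\vdash P_i$; $\Gamma\vdash(\nu xy\colon T)P$ if $\Gamma\vdash_{wf}T$ and $\Gamma,x\colon T,y\colon\overline T\vdash P$; $\Gamma\vdash{*}P$ if $\mathsf{un}(\Gamma)$, $\Gamma\vdash P$; $\Gamma_1\circ\Gamma_2\circ\Gamma_3\vdash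 x\langle v\rangle.P$ if $\Gamma_1\vdash x\colon(q\,!y\colon T.U)$, $\Gamma_2\vdash v\colon T$, $\Gamma_3+x\colon U\{v/y\}\vdash P$; $\Gamma_1\circ\Gamma_2\vdash x(z).P$ if $\Gamma_1\vdash x\colon(q\,?y\colon T.U)$ and $(\Gamma_2,z\colon T)+x\colon U\{z/y\}\vdash P$; $\Gamma_1\vdash(\mathsf{assume}\ \varphi)P$ if $\Gamma_2\vdash\varphi$ and $\Gamma\vdash P$ for some $\Gamma=\Gamma_1\circ\Gamma_2$; $\Gamma_1\circ\Gamma_2\vdash\mathsf{assert}\ \varphi.P$ if $\Gamma_1\vdash\varphi$, $\Gamma_2\vdash P$; $\Gamma,\mathbf 1\vdash P$ if $\Gamma\vdash P$; $\Gamma_1,\varphi_1\otimes\varphi_2,\Gamma_2\vdash P$ if $\Gamma_1,\varphi_1,\varphi_2,\Gamma_2\vdash P$; $\Gamma_1,x\colon\{y\colon T\mid\varphi\},\Gamma_2\vdash P$ if $\Gamma_1,x\colon T,\varphi\{x/y\},\Gamma_2\vdash P$. -}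

module Defs where

open import Data.Nat using (ℕ; zero; suc; _+_; _≤_; _<_; _≟_)
open import Data.List using (List; []; _∷_; _++_; concatMap)
open import Data.List.Membership.Propositional using (_∈_; _∉_)
open import Data.List.Relation.Unary.All using (All)
open import Data.Product using (Σ; _×_; _,_)
open import Data.Unit using (⊤)
open import Data.Empty using (⊥)
open import Relation.Binary.PropositionalEquality using (_≡_; _≢_)

-- Syntax (locally nameless: free variables are names ∈ ℕ, bound
-- variables are de Bruijn indices; hence alpha-equivalent terms are
-- syntactically equal, which realises the alpha-conversion / Barendregt
-- convention of the paper).

data Var : Set where
  fr : ℕ → Var
  bd : ℕ → Var

data Val : Set where
  var   : Var → Val
  unitv : Val

infixr 7 _⊗_
data Fml : Set where
  atom : ℕ → List Val → Fml
  _⊗_  : Fml → Fml → Fml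
  𝟏    : Fml

data Qual : Set where
  lin un : Qual

data Pol : Set where
  inp : Pol
  outp : Pol

-- T ::= unit | end | q p | {x:T | φ} | α | μα.T
-- sess q inp T U   =  q ?x:T.U   (x is bound index 0 in U)
-- sess q outp T U  =  q !x:T.U
-- ref T φ          =  {x:T | φ}  (x is bound index 0 in φ)
-- tvar i, mu T     :  type variables as (separate) de Bruijn indices
data Ty : Set where
  unit end : Ty
  sess     : Qual → Pol → Ty → Ty → Ty
  ref      : Ty → Fml → Ty
  tvar     : ℕ → Ty
  mu       : Ty → Ty

-- Processes.  In  nu T P  (= (νxy:T)P)  x is index 1 and y is index 0
-- in P (T is outside the scope);  recv x P  (= x(y).P)  binds index 0.
infixr 5 _∥_
data Proc : Set where
  send   : Var → Val → Proc → Proc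
  recv   : Var → Proc → Proc
  _∥_    : Proc → Proc → Proc
  rep    : Proc → Proc
  nil    : Proc
  nu     : Ty → Proc → Proc
  assume : Fml → Proc → Proc
  assert : Fml → Proc → Proc

ext : (ℕ → ℕ) → ℕ → ℕ
ext ρ zero = zero
ext ρ (suc i) = suc (ρ i)

renVar : (ℕ → ℕ) → Var → Var
renVar ρ (fr x) = fr x
renVar ρ (bd i) = bd (ρ i)

renV : (ℕ → ℕ) → Val → Val
renV ρ (var x) = var (renVar ρ x)
renV ρ unitv = unitv

renVs : (ℕ → ℕ) → List Val → List Val
renVs ρ [] = []
renVs ρ (v ∷ vs) = renV ρ v ∷ renVs ρ vs

renF : (ℕ → ℕ) → Fml → Fml
renF ρ (atom A vs) = atom A (renVs ρ vs)
renF ρ (φ ⊗ ψ) = renF ρ φ ⊗ renF ρ ψ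
renF ρ 𝟏 = 𝟏

renT : (ℕ → ℕ) → Ty → Ty
renT ρ unit = unit
renT ρ end = end
renT ρ (sess q p T U) = sess q p (renT ρ T) (renT (ext ρ) U)
renT ρ (ref T φ) = ref (renT ρ T) (renF (ext ρ) φ)
renT ρ (tvar i) = tvar i
renT ρ (mu T) = mu (renT ρ T)

renP : (ℕ → ℕ) → Proc → Proc
renP ρ (send x v P) = send (renVar ρ x) (renV ρ v) (renP ρ P)
renP ρ (recv x P) = recv (renVar ρ x) (renP (ext ρ) P)
renP ρ (P ∥ Q) = renP ρ P ∥ renP ρ Q
renP ρ (rep P) = rep (renP ρ P)
renP ρ nil = nil
renP ρ (nu T P) = nu (renT ρ T) (renP (ext (ext ρ)) P)
renP ρ (assume φ P) = assume (renF ρ φ) (renP ρ P)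
renP ρ (assert φ P) = assert (renF ρ φ) (renP ρ P)

-- weakening by two (moving a term into the scope of one ν)
wk2F : Fml → Fml
wk2F = renF (λ i → suc (suc i))

wk2T : Ty → Ty
wk2T = renT (λ i → suc (suc i))

wk2P : Proc → Proc
wk2P = renP (λ i → suc (suc i))

-- exchange of the two innermost ν-binder pairs (indices 0,1 ↔ 2,3)
swap4 : ℕ → ℕ
swap4 0 = 2
swap4 1 = 3
swap4 2 = 0
swap4 3 = 1
swap4 n = n

extsV : (ℕ → Val) → ℕ → Val
extsV σ zero = var (bd zero)
extsV σ (suc i) = renV suc (σ i)

subV : (ℕ → Val) → Val → Val
subV σ (var (fr x)) = var (fr x)
subV σ (var (bd i)) = σ i
subV σ unitv = unitv

subVs : (ℕ → Val) → List Val → List Val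
subVs σ [] = []
subVs σ (v ∷ vs) = subV σ v ∷ subVs σ vs

subF : (ℕ → Val) → Fml → Fml
subF σ (atom A vs) = atom A (subVs σ vs)
subF σ (φ ⊗ ψ) = subF σ φ ⊗ subF σ ψ
subF σ 𝟏 = 𝟏

subT : (ℕ → Val) → Ty → Ty
subT σ unit = unit
subT σ end = end
subT σ (sess q p T U) = sess q p (subT σ T) (subT (extsV σ) U)
subT σ (ref T φ) = ref (subT σ T) (subF (extsV σ) φ)
subT σ (tvar i) = tvar i
subT σ (mu T) = mu (subT σ T)

extsVar : (ℕ → Var) → ℕ → Var
extsVar σ zero = bd zero
extsVar σ (suc i) = renVar suc (σ i)

subVar : (ℕ → Var) → Var → Var
subVar σ (fr x) = fr x
subVar σ (bd i) = σ i

toVal : (ℕ → Var) → ℕ → Val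
toVal σ i = var (σ i)

subP : (ℕ → Var) → Proc → Proc
subP σ (send x v P) = send (subVar σ x) (subV (toVal σ) v) (subP σ P)
subP σ (recv x P) = recv (subVar σ x) (subP (extsVar σ) P)
subP σ (P ∥ Q) = subP σ P ∥ subP σ Q
subP σ (rep P) = rep (subP σ P)
subP σ nil = nil
subP σ (nu T P) = nu (subT (toVal σ) T) (subP (extsVar (extsVar σ)) P)
subP σ (assume φ P) = assume (subF (toVal σ) φ) (subP σ P)
subP σ (assert φ P) = assert (subF (toVal σ) φ) (subP σ P)

σ₀ : Val → ℕ → Val
σ₀ v zero = v
σ₀ v (suc i) = var (bd i)

σ₀Var : Var → ℕ → Var
σ₀Var v zero = v
σ₀Var v (suc i) = bd i

-- φ{v/x} where x is the bound variable of a refinement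
instF : Fml → Val → Fml
instF φ v = subF (σ₀ v) φ

-- U{v/y} where y is the bound variable of a session type
instT : Ty → Val → Ty
instT U v = subT (σ₀ v) U

open1 : Proc → ℕ → Proc
open1 P z = subP (σ₀Var (fr z)) P

open2 : Proc → ℕ → ℕ → Proc
open2 P x y = subP (σ₀Var (fr x)) (subP (σ₀Var (fr y)) P)

tren : (ℕ → ℕ) → Ty → Ty
tren ρ unit = unit
tren ρ end = end
tren ρ (sess q p T U) = sess q p (tren ρ T) (tren ρ U)
tren ρ (ref T φ) = ref (tren ρ T) φ
tren ρ (tvar i) = tvar (ρ i)
tren ρ (mu T) = mu (tren (ext ρ) T)

texts : (ℕ → Ty) → ℕ → Ty
texts σ zero = tvar zero
texts σ (suc i) = tren suc (σ i)

-- under a term binder the substituted types must have their bound term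
-- variables shifted
tsub : (ℕ → Ty) → Ty → Ty
tsub σ unit = unit
tsub σ end = end
tsub σ (sess q p T U) = sess q p (tsub σ T) (tsub (λ i → renT suc (σ i)) U)
tsub σ (ref T φ) = ref (tsub σ T) φ
tsub σ (tvar i) = σ i
tsub σ (mu T) = mu (tsub (texts σ) T)

tσ₀ : Ty → ℕ → Ty
tσ₀ S zero = S
tσ₀ S (suc i) = tvar i

unfold : Ty → Ty
unfold (mu T) = tsub (tσ₀ (mu T)) T
unfold T = T

-- Syntactic restrictions on types (contractive, and no subterm
-- μα1…μαn.{x:T|φ} with n ≥ 1)

headOk : ℕ → Ty → Set
headOk n (mu T) = headOk (suc n) T
headOk n (tvar k) = n ≤ k
headOk n (ref T φ) = ⊥
headOk n unit = ⊤
headOk n end = ⊤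
headOk n (sess q p T U) = ⊤

ValidT : Ty → Set
ValidT unit = ⊤
ValidT end = ⊤
ValidT (sess q p T U) = ValidT T × ValidT U
ValidT (ref T φ) = ValidT T
ValidT (tvar i) = ⊤
ValidT (mu T) = headOk 1 T × ValidT T

ValidP : Proc → Set
ValidP (send x v P) = ValidP P
ValidP (recv x P) = ValidP P
ValidP (P ∥ Q) = ValidP P × ValidP Q
ValidP (rep P) = ValidP P
ValidP nil = ⊤
ValidP (nu T P) = ValidT T × ValidP P
ValidP (assume φ P) = ValidP P
ValidP (assert φ P) = ValidP P

fvVal : Val → List ℕ
fvVal (var (fr x)) = x ∷ []
fvVal (var (bd i)) = []
fvVal unitv = []

fvF : Fml → List ℕ
fvF (atom A vs) = concatMap fvVal vs
fvF (φ ⊗ ψ) = fvF φ ++ fvF ψ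
fvF 𝟏 = []

fvT : Ty → List ℕ
fvT unit = []
fvT end = []
fvT (sess q p T U) = fvT T ++ fvT U
fvT (ref T φ) = fvT T ++ fvF φ
fvT (tvar i) = []
fvT (mu T) = fvT T

fvVar : Var → List ℕ
fvVar (fr x) = x ∷ []
fvVar (bd i) = []

fvP : Proc → List ℕ
fvP (send x v P) = fvVar x ++ fvVal v ++ fvP P
fvP (recv x P) = fvVar x ++ fvP P
fvP (P ∥ Q) = fvP P ++ fvP Q
fvP (rep P) = fvP P
fvP nil = []
fvP (nu T P) = fvT T ++ fvP P
fvP (assume φ P) = fvF φ ++ fvP P
fvP (assert φ P) = fvF φ ++ fvP P

-- LcX d t : all bound indices of t are < d (t is a genuine term at
-- binder depth d; d = 0: no dangling bound variables)
LcVal : ℕ → Val → Set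
LcVal d (var (fr x)) = ⊤
LcVal d (var (bd i)) = i < d
LcVal d unitv = ⊤

LcF : ℕ → Fml → Set
LcF d (atom A vs) = All (LcVal d) vs
LcF d (φ ⊗ ψ) = LcF d φ × LcF d ψ
LcF d 𝟏 = ⊤

LcT : ℕ → Ty → Set
LcT d unit = ⊤
LcT d end = ⊤
LcT d (sess q p T U) = LcT d T × LcT (suc d) U
LcT d (ref T φ) = LcT d T × LcF (suc d) φ
LcT d (tvar i) = ⊤
LcT d (mu T) = LcT d T

data _≃F_ : Fml → Fml → Set where
  ≃F-refl  : ∀ {φ} → φ ≃F φ
  ≃F-sym   : ∀ {φ ψ} → φ ≃F ψ → ψ ≃F φ
  ≃F-trans : ∀ {φ ψ χ} → φ ≃F ψ → ψ ≃F χ → φ ≃F χ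
  ≃F-comm  : ∀ φ₁ φ₂ → (φ₁ ⊗ φ₂) ≃F (φ₂ ⊗ φ₁)
  ≃F-unit  : ∀ φ → (φ ⊗ 𝟏) ≃F φ

data TyStep (R : Ty → Ty → Set) : Ty → Ty → Set where
  st-unit : TyStep R unit unit
  st-end  : TyStep R end end
  st-tvar : ∀ i → TyStep R (tvar i) (tvar i)
  st-sess : ∀ q p {T U T' U'} → R T T' → R U U' →
            TyStep R (sess q p T U) (sess q p T' U')
  st-ref  : ∀ {T T' φ φ'} → R T T' → φ ≃F φ' → TyStep R (ref T φ) (ref T' φ')
  st-muL  : ∀ {T U} → R (unfold (mu T)) U → TyStep R (mu T) U
  st-muR  : ∀ {T U} → R T (unfold (mu U)) → TyStep R T (mu U)

-- coinductive type equivalence: the greatest fixed point of TyStep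
_≃T_ : Ty → Ty → Set₁
T ≃T U = Σ (Ty → Ty → Set) λ R → (∀ a b → R a b → TyStep R a b) × R T U

-- Duality (graph of the partial function  ‾ )

data Dual : Ty → Ty → Set where
  d-in  : ∀ {q T U U'} → Dual U U' → Dual (sess q inp T U) (sess q outp T U')
  d-out : ∀ {q T U U'} → Dual U U' → Dual (sess q outp T U) (sess q inp T U')
  d-end : Dual end end
  d-mu  : ∀ {T T'} → Dual T T' → Dual (mu T) (mu T')
  d-var : ∀ {i} → Dual (tvar i) (tvar i)

-- Contexts (ordered; newest entry on the right)

infixl 5 _▸_∶_ _▹_
data Ctx : Set where
  ∅     : Ctx
  _▸_∶_ : Ctx → ℕ → Ty → Ctx
  _▹_   : Ctx → Fml → Ctx

infixl 4 _⧺_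
_⧺_ : Ctx → Ctx → Ctx
Γ ⧺ ∅ = Γ
Γ ⧺ (Δ ▸ x ∶ T) = (Γ ⧺ Δ) ▸ x ∶ T
Γ ⧺ (Δ ▹ φ) = (Γ ⧺ Δ) ▹ φ

dom : Ctx → List ℕ
dom ∅ = []
dom (Γ ▸ x ∶ T) = x ∷ dom Γ
dom (Γ ▹ φ) = dom Γ

ValidCtx : Ctx → Set
ValidCtx ∅ = ⊤
ValidCtx (Γ ▸ x ∶ T) = ValidCtx Γ × ValidT T
ValidCtx (Γ ▹ φ) = ValidCtx Γ

data UnT : Ty → Set where
  un-unit : UnT unit
  un-end  : UnT end
  un-sess : ∀ {p T U} → UnT (sess un p T U)

data Un : Ctx → Set where
  un-∅ : Un ∅
  un-▸ : ∀ {Γ x T} → Un Γ → UnT T → Un (Γ ▸ x ∶ T)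

_⊢wfF_ : Ctx → Fml → Set
Γ ⊢wfF φ = LcF 0 φ × (∀ {n} → n ∈ fvF φ → n ∈ dom Γ)

_⊢wfT_ : Ctx → Ty → Set
Γ ⊢wfT T = LcT 0 T × (∀ {n} → n ∈ fvT T → n ∈ dom Γ)

data ⊢wf_ : Ctx → Set where
  wf-∅ : ⊢wf ∅
  wf-▸ : ∀ {Γ x T} → ⊢wf Γ → Γ ⊢wfT T → ⊢wf (Γ ▸ x ∶ T)
  wf-▹ : ∀ {Γ φ} → ⊢wf Γ → Γ ⊢wfF φ → ⊢wf (Γ ▹ φ)

-- context split:  Split Γ Γ₁ Γ₂  means  Γ = Γ₁ ∘ Γ₂
data Split : Ctx → Ctx → Ctx → Set where
  s-∅    : Split ∅ ∅ ∅
  s-linL : ∀ {Γ Γ₁ Γ₂ x p T U} → Split Γ Γ₁ Γ₂ → Γ₁ ⊢wfT sess lin p T U →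
           Split (Γ ▸ x ∶ sess lin p T U) (Γ₁ ▸ x ∶ sess lin p T U) Γ₂
  s-linR : ∀ {Γ Γ₁ Γ₂ x p T U} → Split Γ Γ₁ Γ₂ → Γ₂ ⊢wfT sess lin p T U →
           Split (Γ ▸ x ∶ sess lin p T U) Γ₁ (Γ₂ ▸ x ∶ sess lin p T U)
  s-un   : ∀ {Γ Γ₁ Γ₂ x T} → Split Γ Γ₁ Γ₂ → UnT T →
           Split (Γ ▸ x ∶ T) (Γ₁ ▸ x ∶ T) (Γ₂ ▸ x ∶ T)
  s-fmL  : ∀ {Γ Γ₁ Γ₂ φ} → Split Γ Γ₁ Γ₂ → Γ₁ ⊢wfF φ →
           Split (Γ ▹ φ) (Γ₁ ▹ φ) Γ₂
  s-fmR  : ∀ {Γ Γ₁ Γ₂ φ} → Split Γ Γ₁ Γ₂ → Γ₂ ⊢wfF φ →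
           Split (Γ ▹ φ) Γ₁ (Γ₂ ▹ φ)

-- context update:  Upd Γ x T Γ'  means  Γ + x:T = Γ'
data Upd : Ctx → ℕ → Ty → Ctx → Set where
  u-new : ∀ {Γ x T} → x ∉ dom Γ → Γ ⊢wfT T → Upd Γ x T (Γ ▸ x ∶ T)
  u-un  : ∀ {Γ x T} → UnT T → Upd (Γ ▸ x ∶ T) x T (Γ ▸ x ∶ T)

infix 3 _⊢F_ _⊢V_∶_ _⊢P_

data _⊢F_ : Ctx → Fml → Set where
  f-one : ∀ {Γ} → ⊢wf Γ → Un Γ → Γ ⊢F 𝟏
  f-ax  : ∀ {Γ₁ Γ₂ φ} → ⊢wf ((Γ₁ ▹ φ) ⧺ Γ₂) → Un (Γ₁ ⧺ Γ₂) →
          (Γ₁ ▹ φ) ⧺ Γ₂ ⊢F φ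
  f-⊗   : ∀ {Γ Γ₁ Γ₂ φ₁ φ₂} → Split Γ Γ₁ Γ₂ → Γ₁ ⊢F φ₁ → Γ₂ ⊢F φ₂ →
          Γ ⊢F φ₁ ⊗ φ₂

data _⊢V_∶_ : Ctx → Val → Ty → Set₁ where
  v-unit : ∀ {Γ} → ⊢wf Γ → Un Γ → Γ ⊢V unitv ∶ unit
  v-var  : ∀ {Γ₁ Γ₂ x T} → ⊢wf ((Γ₁ ▸ x ∶ T) ⧺ Γ₂) → Un (Γ₁ ⧺ Γ₂) →
           (Γ₁ ▸ x ∶ T) ⧺ Γ₂ ⊢V var (fr x) ∶ T
  v-ref  : ∀ {Γ Γ₁ Γ₂ v T φ} → Split Γ Γ₁ Γ₂ → Γ₁ ⊢F instF φ v →
           Γ₂ ⊢V v ∶ T → Γ ⊢V v ∶ ref T φ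
  v-eq   : ∀ {Γ v T₁ T₂} → Γ ⊢V v ∶ T₁ → T₁ ≃T T₂ → ValidT T₂ →
           Γ ⊢V v ∶ T₂

data _⊢P_ : Ctx → Proc → Set₁ where
  t-nil    : ∀ {Γ} → ⊢wf Γ → Un Γ → Γ ⊢P nil
  t-par    : ∀ {Γ Γ₁ Γ₂ P₁ P₂} → Split Γ Γ₁ Γ₂ → Γ₁ ⊢P P₁ → Γ₂ ⊢P P₂ →
             Γ ⊢P P₁ ∥ P₂
  -- x, y: fresh names (Barendregt convention made explicit)
  t-nu     : ∀ {Γ T T' P} (x y : ℕ) → x ≢ y → x ∉ dom Γ → y ∉ dom Γ →
             x ∉ fvP P → y ∉ fvP P →
             Γ ⊢wfT T → Dual T T' → Γ ▸ x ∶ T ▸ y ∶ T' ⊢P open2 P x y →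
             Γ ⊢P nu T P
  t-rep    : ∀ {Γ P} → Un Γ → Γ ⊢P P → Γ ⊢P rep P
  t-out    : ∀ {Γ Γ₁ Δ Γ₂ Γ₃ Γ₃' x v q T U P} →
             Split Γ Γ₁ Δ → Split Δ Γ₂ Γ₃ →
             Γ₁ ⊢V var (fr x) ∶ sess q outp T U → Γ₂ ⊢V v ∶ T →
             Upd Γ₃ x (instT U v) Γ₃' → Γ₃' ⊢P P →
             Γ ⊢P send (fr x) v P
  t-in     : ∀ {Γ Γ₁ Γ₂ Δ x q T U P} (z : ℕ) → z ∉ dom Γ → z ∉ fvP P →
             z ∉ fvT (sess q inp T U) →
             Split Γ Γ₁ Γ₂ → Γ₁ ⊢V var (fr x) ∶ sess q inp T U →
             Upd (Γ₂ ▸ z ∶ T) x (instT U (var (fr z))) Δ → Δ ⊢P open1 P z →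
             Γ ⊢P recv (fr x) P
  t-assume : ∀ {Γ Γ₁ Γ₂ φ P} → Split Γ Γ₁ Γ₂ → Γ₂ ⊢F φ → Γ ⊢P P →
             Γ₁ ⊢P assume φ P
  t-assert : ∀ {Γ Γ₁ Γ₂ φ P} → Split Γ Γ₁ Γ₂ → Γ₁ ⊢F φ → Γ₂ ⊢P P →
             Γ ⊢P assert φ P
  t-one    : ∀ {Γ P} → Γ ⊢P P → Γ ▹ 𝟏 ⊢P P
  t-⊗      : ∀ {Γ₁ Γ₂ φ₁ φ₂ P} → (Γ₁ ▹ φ₁ ▹ φ₂) ⧺ Γ₂ ⊢P P →
             (Γ₁ ▹ (φ₁ ⊗ φ₂)) ⧺ Γ₂ ⊢P P
  t-ref    : ∀ {Γ₁ Γ₂ x T φ P} → (Γ₁ ▸ x ∶ T ▹ instF φ (var (fr x))) ⧺ Γ₂ ⊢P P →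
             (Γ₁ ▸ x ∶ ref T φ) ⧺ Γ₂ ⊢P P

data HeatAx : Proc → Proc → Set₁ where
  ax-comm    : ∀ {P Q} → HeatAx (P ∥ Q) (Q ∥ P)
  ax-assoc   : ∀ {P Q R} → HeatAx ((P ∥ Q) ∥ R) (P ∥ (Q ∥ R))
  ax-nil     : ∀ {P} → HeatAx (P ∥ nil) P
  ax-rep     : ∀ {P} → HeatAx (rep P) (P ∥ rep P)
  ax-nu-nil  : ∀ {T} → HeatAx (nu T nil) nil
  -- (νxy:T)(P | Q) ≡ (νxy:T)P | Q      (x,y ∉ fv(Q))
  ax-nu-par  : ∀ {T P Q} → HeatAx (nu T (P ∥ wk2P Q)) (nu T P ∥ Q)
  -- (νwz:T)(νxy:U)P ≡ (νxy:U)(νwz:T)P  (w,z ∉ fv(U), x,y ∉ fv(T))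
  ax-nu-nu   : ∀ {T U P} →
               HeatAx (nu T (nu (wk2T U) P)) (nu U (nu (wk2T T) (renP swap4 P)))
  -- (νxy:T)(assume φ)P ≡ (assume φ)(νxy:T)P   (x,y ∉ fv(φ))
  ax-nu-asm  : ∀ {T φ P} → HeatAx (nu T (assume (wk2F φ) P)) (assume φ (nu T P))
  ax-asm-1   : ∀ {P} → HeatAx (assume 𝟏 P) P
  ax-ast-1   : ∀ {P} → HeatAx (assert 𝟏 P) P
  ax-asm-asm : ∀ {φ₁ φ₂ P} → HeatAx (assume φ₁ (assume φ₂ P)) (assume φ₂ (assume φ₁ P))
  ax-ast-ast : ∀ {φ₁ φ₂ P} → HeatAx (assert φ₁ (assert φ₂ P)) (assert φ₂ (assert φ₁ P))
  ax-ast-⊗   : ∀ {φ₁ φ₂ P} → HeatAx (assert (φ₁ ⊗ φ₂) P) (assert φ₁ (assert φ₂ P))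
  ax-asm-⊗   : ∀ {φ₁ φ₂ P} → HeatAx (assume (φ₁ ⊗ φ₂) P) (assume φ₁ (assume φ₂ P))
  ax-nu-ty   : ∀ {T U P} → T ≃T U → ValidT T → ValidT U → HeatAx (nu T P) (nu U P)

infix 2 _⇛_
data _⇛_ : Proc → Proc → Set₁ where
  h-refl   : ∀ {P} → P ⇛ P
  h-trans  : ∀ {P Q R} → P ⇛ Q → Q ⇛ R → P ⇛ R
  h-ax     : ∀ {P Q} → HeatAx P Q → P ⇛ Q
  h-xa     : ∀ {P Q} → HeatAx P Q → Q ⇛ P
  h-extr   : ∀ {φ P Q} → (assume φ P ∥ Q) ⇛ assume φ (P ∥ Q)
  h-send   : ∀ {x v P P'} → P ⇛ P' → send x v P ⇛ send x v P'
  h-recv   : ∀ {x P P'} → P ⇛ P' → recv x P ⇛ recv x P'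
  h-parL   : ∀ {P P' Q} → P ⇛ P' → P ∥ Q ⇛ P' ∥ Q
  h-parR   : ∀ {P Q Q'} → Q ⇛ Q' → P ∥ Q ⇛ P ∥ Q'
  h-rep    : ∀ {P P'} → P ⇛ P' → rep P ⇛ rep P'
  h-nu     : ∀ {T P P'} → P ⇛ P' → nu T P ⇛ nu T P'
  h-assume : ∀ {φ P P'} → P ⇛ P' → assume φ P ⇛ assume φ P'
  h-assert : ∀ {φ P P'} → P ⇛ P' → assert φ P ⇛ assert φ P'

data IsAtom : Fml → Set where
  is-atom : ∀ A vs → IsAtom (atom A vs)

NonStruct : Proc → Set
NonStruct (nu T P) = ⊥
NonStruct (assume φ P) = ⊥
NonStruct (P ∥ Q) = ⊥
NonStruct (send x v P) = ⊤
NonStruct (recv x P) = ⊤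
NonStruct (rep P) = ⊤
NonStruct nil = ⊤
NonStruct (assert φ P) = ⊤

nus : List Ty → Proc → Proc
nus [] P = P
nus (T ∷ Ts) P = nu T (nus Ts P)

assumes : List Fml → Proc → Proc
assumes [] P = P
assumes (A ∷ As) P = assume A (assumes As P)

pars : Proc → List Proc → Proc
pars P [] = P
pars P (Q ∷ Qs) = P ∥ pars Q Qs

canon : List Ty → List Fml → Proc → List Proc → Proc
canon Ts As P Ps = nus Ts (assumes As (pars P Ps))

Safe : Proc → Set₁
Safe Q = ∀ (Ts : List Ty) (As : List Fml) (P : Proc) (Ps : List Proc) →
         Q ⇛ canon Ts As P Ps → All IsAtom As → All NonStruct (P ∷ Ps) →
         ∀ (B : Fml) (R : Proc) → assert B R ∈ (P ∷ Ps) → IsAtom B → B ∈ As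

module Submission where

-- Safety only inspects what heating can bring to the top level: the
-- restrictions, assumes, asserts, parallel compositions and replications
-- above the first input/output prefix.  We abstract a process to this
-- skeleton and define the invariant  Covered E Φ : the multiset Φ of atomic
-- formulae can be shared out over the parallel components of E so that
-- every top-level assert consumes available atoms (assumes add atoms,
-- ν-binders shift their variables, replicated bodies get none, prefixes
-- discard whatever they receive).

open import Defs
open import Data.Nat using (ℕ; zero; suc; _≟_)
open import Data.List using (List; []; _∷_; _++_; map; concatMap)
open import Data.List.Properties
  using (map-++; map-∘; map-cong; map-cong-local; map-id; map-injective; ∷-injective; ++-assoc; ++-identityʳ)
open import Data.List.Membership.Propositional using (_∈_; _∉_)
open import Data.List.Membership.Propositional.Properties using (∈-++⁺ˡ; ∈-++⁺ʳ; ∈-++⁻)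
open import Data.List.Relation.Unary.All using (All; []; _∷_; tabulate)
open import Data.List.Relation.Unary.Any using (here; there)
open import Data.List.Relation.Binary.Permutation.Propositional
  using (_↭_; ↭-refl; ↭-sym; ↭-trans; ↭-reflexive)
import Data.List.Relation.Binary.Permutation.Propositional.Properties as ↭
open import Data.Product using (Σ; _×_; _,_; proj₁; proj₂)
open import Data.Sum using (_⊎_; inj₁; inj₂)
open import Data.Unit using (⊤; tt)
open import Data.Empty using (⊥; ⊥-elim)
open import Function using (_∘_; id)
open import Function.Definitions using (Injective)
open import Relation.Nullary using (¬_; yes; no)
open import Relation.Binary.PropositionalEquality

data Skel : Set where
  leaf : Skel
  par  : Skel → Skel → Skel
  bang : Skel → Skel
  new  : Skel → Skel
  asm  : Fml → Skel → Skel
  ast  : Fml → Skel → Skel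

skel : Proc → Skel
skel (send x v P) = leaf
skel (recv x P) = leaf
skel (P ∥ Q) = par (skel P) (skel Q)
skel (rep P) = bang (skel P)
skel nil = leaf
skel (nu T P) = new (skel P)
skel (assume φ P) = asm φ (skel P)
skel (assert φ P) = ast φ (skel P)

fvS : Skel → List ℕ
fvS leaf = []
fvS (par E F) = fvS E ++ fvS F
fvS (bang E) = fvS E
fvS (new E) = fvS E
fvS (asm φ E) = fvF φ ++ fvS E
fvS (ast φ E) = fvF φ ++ fvS E

fvS-skel : ∀ P {n} → n ∈ fvS (skel P) → n ∈ fvP P
fvS-skel (send x v P) ()
fvS-skel (recv x P) ()
fvS-skel nil ()
fvS-skel (P ∥ Q) m with ∈-++⁻ (fvS (skel P)) m
... | inj₁ m′ = ∈-++⁺ˡ (fvS-skel P m′)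
... | inj₂ m′ = ∈-++⁺ʳ (fvP P) (fvS-skel Q m′)
fvS-skel (rep P) m = fvS-skel P m
fvS-skel (nu T P) m = ∈-++⁺ʳ (fvT T) (fvS-skel P m)
fvS-skel (assume φ P) m with ∈-++⁻ (fvF φ) m
... | inj₁ m′ = ∈-++⁺ˡ m′
... | inj₂ m′ = ∈-++⁺ʳ (fvF φ) (fvS-skel P m′)
fvS-skel (assert φ P) m with ∈-++⁻ (fvF φ) m
... | inj₁ m′ = ∈-++⁺ˡ m′
... | inj₂ m′ = ∈-++⁺ʳ (fvF φ) (fvS-skel P m′)

-- Renamings and variable-for-variable substitutions are both maps on
-- variables; one action on skeletons covers both.
Act : Set
Act = Var → Var

shift : Act
shift (fr n) = fr n
shift (bd i) = bd (suc i)

shift2 : Act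
shift2 = shift ∘ shift

lift : Act → Act
lift h (bd zero) = bd zero
lift h (bd (suc i)) = shift (h (bd i))
lift h (fr n) = shift (h (fr n))

mapVal : Act → Val → Val
mapVal h (var x) = var (h x)
mapVal h unitv = unitv

mapFml : Act → Fml → Fml
mapFml h (atom A vs) = atom A (map (mapVal h) vs)
mapFml h (φ ⊗ ψ) = mapFml h φ ⊗ mapFml h ψ
mapFml h 𝟏 = 𝟏

mapSkel : Act → Skel → Skel
mapSkel h leaf = leaf
mapSkel h (par E F) = par (mapSkel h E) (mapSkel h F)
mapSkel h (bang E) = bang (mapSkel h E)
mapSkel h (new E) = new (mapSkel (lift (lift h)) E)
mapSkel h (asm φ E) = asm (mapFml h φ) (mapSkel h E)
mapSkel h (ast φ E) = ast (mapFml h φ) (mapSkel h E)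

-- Bad : ℕ → Set singles out the names a statement must stay away from;
-- a bound variable is never bad
Avoids : (ℕ → Set) → Var → Set
Avoids Bad (fr n) = ¬ Bad n
Avoids Bad (bd i) = ⊤

Agree : (ℕ → Set) → Act → Act → Set
Agree Bad f g = ∀ v → Avoids Bad v → f v ≡ g v

Fresh : (ℕ → Set) → List ℕ → Set
Fresh Bad ns = ∀ {n} → n ∈ ns → ¬ Bad n

lift-shift : ∀ h v → lift h (shift v) ≡ shift (h v)
lift-shift h (fr n) = refl
lift-shift h (bd i) = refl

lift-fuse : ∀ {f g k} → (∀ v → f (g v) ≡ k v) → ∀ v → lift f (lift g v) ≡ lift k v
lift-fuse e (bd zero) = refl
lift-fuse {f} {g} e (bd (suc i)) = trans (lift-shift f (g (bd i))) (cong shift (e (bd i)))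
lift-fuse {f} {g} e (fr n) = trans (lift-shift f (g (fr n))) (cong shift (e (fr n)))

lift-fixes : ∀ {Bad h} → Agree Bad h id → Agree Bad (lift h) id
lift-fixes ag (bd zero) ok = refl
lift-fixes ag (bd (suc i)) ok = cong shift (ag (bd i) tt)
lift-fixes ag (fr n) ok = cong shift (ag (fr n) ok)

mapVal-fuse : ∀ {f g k} → (∀ v → f (g v) ≡ k v) → ∀ v → mapVal f (mapVal g v) ≡ mapVal k v
mapVal-fuse e (var x) = cong var (e x)
mapVal-fuse e unitv = refl

mapFml-fuse : ∀ {f g k} → (∀ v → f (g v) ≡ k v) → ∀ φ → mapFml f (mapFml g φ) ≡ mapFml k φ
mapFml-fuse e (atom A vs) = cong (atom A) (trans (sym (map-∘ vs)) (map-cong (mapVal-fuse e) vs))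
mapFml-fuse e (φ ⊗ ψ) = cong₂ _⊗_ (mapFml-fuse e φ) (mapFml-fuse e ψ)
mapFml-fuse e 𝟏 = refl

mapFml-id : ∀ φ → mapFml id φ ≡ φ
mapFml-id (atom A vs) = cong (atom A) (trans (map-cong mapVal-id vs) (map-id vs))
  where
  mapVal-id : ∀ v → mapVal id v ≡ v
  mapVal-id (var x) = refl
  mapVal-id unitv = refl
mapFml-id (φ ⊗ ψ) = cong₂ _⊗_ (mapFml-id φ) (mapFml-id ψ)
mapFml-id 𝟏 = refl

mapFml-agree : ∀ {Bad f g} → Agree Bad f g → ∀ φ → Fresh Bad (fvF φ) → mapFml f φ ≡ mapFml g φ
mapFml-agree {Bad} {f} {g} ag (atom A vs) fresh = cong (atom A) (args vs fresh)
  where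
  args : ∀ vs → Fresh Bad (concatMap fvVal vs) → map (mapVal f) vs ≡ map (mapVal g) vs
  args [] _ = refl
  args (var (fr n) ∷ vs) fresh =
    cong₂ _∷_ (cong var (ag (fr n) (fresh (here refl)))) (args vs (λ m → fresh (there m)))
  args (var (bd i) ∷ vs) fresh = cong₂ _∷_ (cong var (ag (bd i) tt)) (args vs fresh)
  args (unitv ∷ vs) fresh = cong (unitv ∷_) (args vs fresh)
mapFml-agree ag (φ ⊗ ψ) fresh =
  cong₂ _⊗_ (mapFml-agree ag φ (λ m → fresh (∈-++⁺ˡ m)))
            (mapFml-agree ag ψ (λ m → fresh (∈-++⁺ʳ (fvF φ) m)))
mapFml-agree ag 𝟏 fresh = refl

mapFml-fixes : ∀ {Bad h} → Agree Bad h id → ∀ φ → Fresh Bad (fvF φ) → mapFml h φ ≡ φ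
mapFml-fixes ag φ fresh = trans (mapFml-agree ag φ fresh) (mapFml-id φ)

mapSkel-fuse : ∀ {f g k} → (∀ v → f (g v) ≡ k v) → ∀ E → mapSkel f (mapSkel g E) ≡ mapSkel k E
mapSkel-fuse e leaf = refl
mapSkel-fuse e (par E F) = cong₂ par (mapSkel-fuse e E) (mapSkel-fuse e F)
mapSkel-fuse e (bang E) = cong bang (mapSkel-fuse e E)
mapSkel-fuse e (new E) = cong new (mapSkel-fuse (lift-fuse (lift-fuse e)) E)
mapSkel-fuse e (asm φ E) = cong₂ asm (mapFml-fuse e φ) (mapSkel-fuse e E)
mapSkel-fuse e (ast φ E) = cong₂ ast (mapFml-fuse e φ) (mapSkel-fuse e E)

mapSkel-fixes : ∀ {Bad h} → Agree Bad h id → ∀ E → Fresh Bad (fvS E) → mapSkel h E ≡ E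
mapSkel-fixes ag leaf fresh = refl
mapSkel-fixes ag (par E F) fresh =
  cong₂ par (mapSkel-fixes ag E (λ m → fresh (∈-++⁺ˡ m)))
            (mapSkel-fixes ag F (λ m → fresh (∈-++⁺ʳ (fvS E) m)))
mapSkel-fixes ag (bang E) fresh = cong bang (mapSkel-fixes ag E fresh)
mapSkel-fixes ag (new E) fresh = cong new (mapSkel-fixes (lift-fixes (lift-fixes ag)) E fresh)
mapSkel-fixes ag (asm φ E) fresh =
  cong₂ asm (mapFml-fixes ag φ (λ m → fresh (∈-++⁺ˡ m)))
            (mapSkel-fixes ag E (λ m → fresh (∈-++⁺ʳ (fvF φ) m)))
mapSkel-fixes ag (ast φ E) fresh =
  cong₂ ast (mapFml-fixes ag φ (λ m → fresh (∈-++⁺ˡ m)))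
            (mapSkel-fixes ag E (λ m → fresh (∈-++⁺ʳ (fvF φ) m)))

shift-injective : Injective _≡_ _≡_ shift
shift-injective {fr n} {fr .n} refl = refl
shift-injective {bd i} {bd .i} refl = refl

data LiftView : Var → Set where
  at-zero : LiftView (bd zero)
  shifted : ∀ w → LiftView (shift w)

liftView : ∀ v → LiftView v
liftView (bd zero) = at-zero
liftView (bd (suc i)) = shifted (bd i)
liftView (fr n) = shifted (fr n)

zero≢shift : ∀ w → bd zero ≢ shift w
zero≢shift (fr n) ()
zero≢shift (bd i) ()

lift-injective : ∀ {h} → Injective _≡_ _≡_ h → Injective _≡_ _≡_ (lift h)
lift-injective {h} inj {v} {v′} e with liftView v | liftView v′
... | at-zero | at-zero = refl
... | at-zero | shifted w′ = ⊥-elim (zero≢shift (h w′) (trans e (lift-shift h w′)))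
... | shifted w | at-zero = ⊥-elim (zero≢shift (h w) (trans (sym e) (lift-shift h w)))
... | shifted w | shifted w′ =
  cong shift (inj (shift-injective (trans (sym (lift-shift h w)) (trans e (lift-shift h w′)))))

var-injective : ∀ {x y} → var x ≡ var y → x ≡ y
var-injective refl = refl

atom-injective : ∀ {A B vs ws} → atom A vs ≡ atom B ws → A ≡ B × vs ≡ ws
atom-injective refl = refl , refl

⊗-injective : ∀ {φ φ′ ψ ψ′} → φ ⊗ φ′ ≡ ψ ⊗ ψ′ → φ ≡ ψ × φ′ ≡ ψ′
⊗-injective refl = refl , refl

mapVal-injective : ∀ {h} → Injective _≡_ _≡_ h → Injective _≡_ _≡_ (mapVal h)
mapVal-injective inj {var x} {var y} e = cong var (inj (var-injective e))
mapVal-injective inj {var x} {unitv} ()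
mapVal-injective inj {unitv} {var y} ()
mapVal-injective inj {unitv} {unitv} e = refl

mapFml-injective : ∀ {h} → Injective _≡_ _≡_ h → Injective _≡_ _≡_ (mapFml h)
mapFml-injective inj {atom A vs} {atom B ws} e with atom-injective e
... | refl , e′ = cong (atom A) (map-injective (mapVal-injective inj) e′)
mapFml-injective inj {φ ⊗ φ′} {ψ ⊗ ψ′} e with ⊗-injective e
... | e₁ , e₂ = cong₂ _⊗_ (mapFml-injective inj e₁) (mapFml-injective inj e₂)
mapFml-injective inj {𝟏} {𝟏} e = refl
mapFml-injective inj {atom _ _} {_ ⊗ _} ()
mapFml-injective inj {atom _ _} {𝟏} ()
mapFml-injective inj {_ ⊗ _} {atom _ _} ()
mapFml-injective inj {_ ⊗ _} {𝟏} ()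
mapFml-injective inj {𝟏} {atom _ _} ()
mapFml-injective inj {𝟏} {_ ⊗ _} ()

atoms : Fml → List Fml
atoms (atom A vs) = atom A vs ∷ []
atoms (φ ⊗ ψ) = atoms φ ++ atoms ψ
atoms 𝟏 = []

atoms-map : ∀ h φ → atoms (mapFml h φ) ≡ map (mapFml h) (atoms φ)
atoms-map h (atom A vs) = refl
atoms-map h (φ ⊗ ψ) =
  trans (cong₂ _++_ (atoms-map h φ) (atoms-map h ψ)) (sym (map-++ (mapFml h) (atoms φ) (atoms ψ)))
atoms-map h 𝟏 = refl

-- moving a formula into the scope of one ν-binder
shiftF : Fml → Fml
shiftF = mapFml shift2

Covered : Skel → List Fml → Set
Covered leaf Φ = ⊤
Covered (par E F) Φ =
  Σ (List Fml) λ Φ₁ → Σ (List Fml) λ Φ₂ → (Φ₁ ++ Φ₂ ↭ Φ) × Covered E Φ₁ × Covered F Φ₂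
Covered (bang E) Φ = Covered E []
Covered (new E) Φ = Covered E (map shiftF Φ)
Covered (asm φ E) Φ = Covered E (atoms φ ++ Φ)
Covered (ast φ E) Φ = Σ (List Fml) λ Ψ → (atoms φ ++ Ψ ↭ Φ) × Covered E Ψ

Covered-↭ : ∀ E {Φ Ψ} → Φ ↭ Ψ → Covered E Φ → Covered E Ψ
Covered-↭ leaf p c = tt
Covered-↭ (par E F) p (Φ₁ , Φ₂ , q , c₁ , c₂) = Φ₁ , Φ₂ , ↭-trans q p , c₁ , c₂
Covered-↭ (bang E) p c = c
Covered-↭ (new E) p c = Covered-↭ E (↭.map⁺ shiftF p) c
Covered-↭ (asm φ E) p c = Covered-↭ E (↭.++⁺ˡ (atoms φ) p) c
Covered-↭ (ast φ E) p (Ψ , q , c) = Ψ , ↭-trans q p , c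

-- surplus atoms can always be discarded (at the leaves)
Covered-weaken : ∀ E Φ Ψ → Covered E Φ → Covered E (Φ ++ Ψ)
Covered-weaken leaf Φ Ψ c = tt
Covered-weaken (par E F) Φ Ψ (Φ₁ , Φ₂ , p , c₁ , c₂) =
  Φ₁ , Φ₂ ++ Ψ , ↭-trans (↭-sym (↭.++-assoc Φ₁ Φ₂ Ψ)) (↭.++⁺ʳ Ψ p) , c₁ , Covered-weaken F Φ₂ Ψ c₂
Covered-weaken (bang E) Φ Ψ c = c
Covered-weaken (new E) Φ Ψ c =
  subst (Covered E) (sym (map-++ shiftF Φ Ψ)) (Covered-weaken E (map shiftF Φ) (map shiftF Ψ) c)
Covered-weaken (asm φ E) Φ Ψ c =
  subst (Covered E) (++-assoc (atoms φ) Φ Ψ) (Covered-weaken E (atoms φ ++ Φ) Ψ c)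
Covered-weaken (ast φ E) Φ Ψ (Ψ′ , p , c) =
  Ψ′ ++ Ψ , ↭-trans (↭-sym (↭.++-assoc (atoms φ) Ψ′ Ψ)) (↭.++⁺ʳ Ψ p) , Covered-weaken E Ψ′ Ψ c

map-≡-++ : ∀ {A B : Set} (f : A → B) Φ Ψ₁ Ψ₂ → map f Φ ≡ Ψ₁ ++ Ψ₂ →
           Σ (List A) λ Φ₁ → Σ (List A) λ Φ₂ →
           (Φ ≡ Φ₁ ++ Φ₂) × (Ψ₁ ≡ map f Φ₁) × (Ψ₂ ≡ map f Φ₂)
map-≡-++ f Φ [] Ψ₂ e = [] , Φ , refl , refl , sym e
map-≡-++ f [] (ψ ∷ Ψ₁) Ψ₂ ()
map-≡-++ f (φ ∷ Φ) (ψ ∷ Ψ₁) Ψ₂ e with ∷-injective e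
... | e₁ , e₂ with map-≡-++ f Φ Ψ₁ Ψ₂ e₂
...   | Φ₁ , Φ₂ , refl , refl , refl = φ ∷ Φ₁ , Φ₂ , refl , cong (_∷ map f Φ₁) (sym e₁) , refl

map-↭-++ : ∀ {A B : Set} (f : A → B) Φ Ψ₁ Ψ₂ → Ψ₁ ++ Ψ₂ ↭ map f Φ →
           Σ (List A) λ Φ₁ → Σ (List A) λ Φ₂ →
           (Φ₁ ++ Φ₂ ↭ Φ) × (Ψ₁ ≡ map f Φ₁) × (Ψ₂ ≡ map f Φ₂)
map-↭-++ f Φ Ψ₁ Ψ₂ p with ↭.↭-map-inv f (↭-sym p)
... | Φ′ , e , q with map-≡-++ f Φ′ Ψ₁ Ψ₂ (sym e)
...   | Φ₁ , Φ₂ , refl , e₁ , e₂ = Φ₁ , Φ₂ , ↭-sym q , e₁ , e₂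

shiftF-lift : ∀ h φ → mapFml (lift (lift h)) (shiftF φ) ≡ shiftF (mapFml h φ)
shiftF-lift h φ =
  trans (mapFml-fuse (λ v → trans (lift-shift (lift h) (shift v)) (cong shift (lift-shift h v))) φ)
        (sym (mapFml-fuse (λ v → refl) φ))

map-shiftF-lift : ∀ h Φ → map (mapFml (lift (lift h))) (map shiftF Φ) ≡ map shiftF (map (mapFml h) Φ)
map-shiftF-lift h Φ = trans (sym (map-∘ Φ)) (trans (map-cong (shiftF-lift h) Φ) (map-∘ Φ))

atoms-++-map : ∀ h φ Φ → atoms (mapFml h φ) ++ map (mapFml h) Φ ≡ map (mapFml h) (atoms φ ++ Φ)
atoms-++-map h φ Φ = trans (cong (_++ _) (atoms-map h φ)) (sym (map-++ (mapFml h) (atoms φ) Φ))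

Covered-rename : ∀ {h} → Injective _≡_ _≡_ h →
                 ∀ E Φ → Covered E Φ → Covered (mapSkel h E) (map (mapFml h) Φ)
Covered-rename inj leaf Φ c = tt
Covered-rename {h} inj (par E F) Φ (Φ₁ , Φ₂ , p , c₁ , c₂) =
  map (mapFml h) Φ₁ , map (mapFml h) Φ₂ ,
  ↭-trans (↭-reflexive (sym (map-++ (mapFml h) Φ₁ Φ₂))) (↭.map⁺ (mapFml h) p) ,
  Covered-rename inj E Φ₁ c₁ , Covered-rename inj F Φ₂ c₂
Covered-rename inj (bang E) Φ c = Covered-rename inj E [] c
Covered-rename {h} inj (new E) Φ c =
  subst (Covered (mapSkel (lift (lift h)) E)) (map-shiftF-lift h Φ)
        (Covered-rename (lift-injective (lift-injective inj)) E (map shiftF Φ) c)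
Covered-rename {h} inj (asm φ E) Φ c =
  subst (Covered (mapSkel h E)) (sym (atoms-++-map h φ Φ)) (Covered-rename inj E (atoms φ ++ Φ) c)
Covered-rename {h} inj (ast φ E) Φ (Ψ , p , c) =
  map (mapFml h) Ψ , ↭-trans (↭-reflexive (atoms-++-map h φ Ψ)) (↭.map⁺ (mapFml h) p) ,
  Covered-rename inj E Ψ c

Covered-unrename : ∀ {h} → Injective _≡_ _≡_ h →
                   ∀ E Φ → Covered (mapSkel h E) (map (mapFml h) Φ) → Covered E Φ
Covered-unrename inj leaf Φ c = tt
Covered-unrename {h} inj (par E F) Φ (Ψ₁ , Ψ₂ , p , c₁ , c₂) with map-↭-++ (mapFml h) Φ Ψ₁ Ψ₂ p
... | Φ₁ , Φ₂ , q , refl , refl =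
  Φ₁ , Φ₂ , q , Covered-unrename inj E Φ₁ c₁ , Covered-unrename inj F Φ₂ c₂
Covered-unrename inj (bang E) Φ c = Covered-unrename inj E [] c
Covered-unrename {h} inj (new E) Φ c =
  Covered-unrename (lift-injective (lift-injective inj)) E (map shiftF Φ)
    (subst (Covered (mapSkel (lift (lift h)) E)) (sym (map-shiftF-lift h Φ)) c)
Covered-unrename {h} inj (asm φ E) Φ c =
  Covered-unrename inj E (atoms φ ++ Φ) (subst (Covered (mapSkel h E)) (atoms-++-map h φ Φ) c)
Covered-unrename {h} inj (ast φ E) Φ (Ψ , p , c)
  with map-↭-++ (mapFml h) Φ (atoms (mapFml h φ)) Ψ p
... | Φ₁ , Φ₂ , q , e , refl
  with map-injective (mapFml-injective inj) (trans (sym (atoms-map h φ)) e)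
...   | refl = Φ₂ , q , Covered-unrename inj E Φ₂ c

-- Skeletons of renamed and substituted processes: the renaming renP and
-- the substitution subP of the syntax act on skeletons as the variable
-- actions renVar and subVar (stated up to pointwise equal actions, so that
-- the statements survive going under binders).

lift-renVar : ∀ {ρ h} → h ≗ renVar ρ → lift h ≗ renVar (ext ρ)
lift-renVar e (bd zero) = refl
lift-renVar e (bd (suc i)) = cong shift (e (bd i))
lift-renVar e (fr n) = cong shift (e (fr n))

renF-mapFml : ∀ {ρ h} → h ≗ renVar ρ → ∀ φ → renF ρ φ ≡ mapFml h φ
renF-mapFml {ρ} {h} e (atom A vs) = cong (atom A) (args vs)
  where
  args : ∀ vs → renVs ρ vs ≡ map (mapVal h) vs
  args [] = refl
  args (var x ∷ vs) = cong₂ _∷_ (cong var (sym (e x))) (args vs)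
  args (unitv ∷ vs) = cong (unitv ∷_) (args vs)
renF-mapFml e (φ ⊗ ψ) = cong₂ _⊗_ (renF-mapFml e φ) (renF-mapFml e ψ)
renF-mapFml e 𝟏 = refl

skel-renP : ∀ {ρ h} → h ≗ renVar ρ → ∀ P → skel (renP ρ P) ≡ mapSkel h (skel P)
skel-renP e (send x v P) = refl
skel-renP e (recv x P) = refl
skel-renP e (P ∥ Q) = cong₂ par (skel-renP e P) (skel-renP e Q)
skel-renP e (rep P) = cong bang (skel-renP e P)
skel-renP e nil = refl
skel-renP e (nu T P) = cong new (skel-renP (lift-renVar (lift-renVar e)) P)
skel-renP e (assume φ P) = cong₂ asm (renF-mapFml e φ) (skel-renP e P)
skel-renP e (assert φ P) = cong₂ ast (renF-mapFml e φ) (skel-renP e P)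

lift-subVar : ∀ {σ h} → h ≗ subVar σ → lift h ≗ subVar (extsVar σ)
lift-subVar e (bd zero) = refl
lift-subVar {σ} e (bd (suc i)) = trans (cong shift (e (bd i))) (shift-renVar (σ i))
  where
  shift-renVar : ∀ v → shift v ≡ renVar suc v
  shift-renVar (fr n) = refl
  shift-renVar (bd i) = refl
lift-subVar e (fr n) = cong shift (e (fr n))

subF-mapFml : ∀ {σ h} → h ≗ subVar σ → ∀ φ → subF (toVal σ) φ ≡ mapFml h φ
subF-mapFml {σ} {h} e (atom A vs) = cong (atom A) (args vs)
  where
  args : ∀ vs → subVs (toVal σ) vs ≡ map (mapVal h) vs
  args [] = refl
  args (var (fr x) ∷ vs) = cong₂ _∷_ (cong var (sym (e (fr x)))) (args vs)
  args (var (bd i) ∷ vs) = cong₂ _∷_ (cong var (sym (e (bd i)))) (args vs)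
  args (unitv ∷ vs) = cong (unitv ∷_) (args vs)
subF-mapFml e (φ ⊗ ψ) = cong₂ _⊗_ (subF-mapFml e φ) (subF-mapFml e ψ)
subF-mapFml e 𝟏 = refl

skel-subP : ∀ {σ h} → h ≗ subVar σ → ∀ P → skel (subP σ P) ≡ mapSkel h (skel P)
skel-subP e (send x v P) = refl
skel-subP e (recv x P) = refl
skel-subP e (P ∥ Q) = cong₂ par (skel-subP e P) (skel-subP e Q)
skel-subP e (rep P) = cong bang (skel-subP e P)
skel-subP e nil = refl
skel-subP e (nu T P) = cong new (skel-subP (lift-subVar (lift-subVar e)) P)
skel-subP e (assume φ P) = cong₂ asm (subF-mapFml e φ) (skel-subP e P)
skel-subP e (assert φ P) = cong₂ ast (subF-mapFml e φ) (skel-subP e P)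

infix 2 _⊑_
_⊑_ : Proc → Proc → Set
P ⊑ Q = ∀ Φ → Covered (skel P) Φ → Covered (skel Q) Φ

shift2-injective : Injective _≡_ _≡_ shift2
shift2-injective = shift-injective ∘ shift-injective

skel-wk2P : ∀ Q → skel (wk2P Q) ≡ mapSkel shift2 (skel Q)
skel-wk2P = skel-renP λ { (fr n) → refl ; (bd i) → refl }

swap2 : Act
swap2 = renVar swap4

swap2-involutive : ∀ v → swap2 (swap2 v) ≡ v
swap2-involutive (fr n) = refl
swap2-involutive (bd 0) = refl
swap2-involutive (bd 1) = refl
swap2-involutive (bd 2) = refl
swap2-involutive (bd 3) = refl
swap2-involutive (bd (suc (suc (suc (suc i))))) = refl

swap2-injective : Injective _≡_ _≡_ swap2
swap2-injective {v} {w} e = trans (sym (swap2-involutive v)) (trans (cong swap2 e) (swap2-involutive w))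

swap2-shifted : ∀ Φ → map (mapFml swap2) (map shiftF (map shiftF Φ)) ≡ map shiftF (map shiftF Φ)
swap2-shifted [] = refl
swap2-shifted (φ ∷ Φ) = cong₂ _∷_ (swap-shift4 φ) (swap2-shifted Φ)
  where
  swap-shift4 : ∀ φ → mapFml swap2 (shiftF (shiftF φ)) ≡ shiftF (shiftF φ)
  swap-shift4 φ = trans (cong (mapFml swap2) (mapFml-fuse (λ v → refl) φ))
                   (trans (mapFml-fuse (λ { (fr n) → refl ; (bd i) → refl }) φ)
                          (sym (mapFml-fuse (λ v → refl) φ)))

skel-swap : ∀ P → skel (renP swap4 P) ≡ mapSkel swap2 (skel P)
skel-swap = skel-renP (λ v → refl)

atoms-wk2F : ∀ φ Φ → map shiftF (atoms φ ++ Φ) ≡ atoms (wk2F φ) ++ map shiftF Φ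
atoms-wk2F φ Φ =
  trans (map-++ shiftF (atoms φ) Φ)
        (cong (_++ map shiftF Φ) (trans (sym (atoms-map shift2 φ))
                                         (cong atoms (sym (renF-mapFml (λ { (fr n) → refl ; (bd i) → refl }) φ)))))

par-comm : ∀ {E F} Φ → Covered (par E F) Φ → Covered (par F E) Φ
par-comm Φ (Φ₁ , Φ₂ , p , c₁ , c₂) = Φ₂ , Φ₁ , ↭-trans (↭.++-comm Φ₂ Φ₁) p , c₂ , c₁

ast-comm : ∀ φ₁ φ₂ E Φ → Covered (ast φ₁ (ast φ₂ E)) Φ → Covered (ast φ₂ (ast φ₁ E)) Φ
ast-comm φ₁ φ₂ E Φ (Ψ , p , (Ψ′ , q , c)) =
  atoms φ₁ ++ Ψ′ , ↭-trans (↭.shifts (atoms φ₂) (atoms φ₁)) (↭-trans (↭.++⁺ˡ (atoms φ₁) q) p) ,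
  (Ψ′ , ↭-refl , c)

heatAx-forward : ∀ {P Q} → HeatAx P Q → P ⊑ Q
heatAx-forward (ax-comm {P} {Q}) = par-comm {skel P} {skel Q}
heatAx-forward ax-assoc Φ (Φ₁₂ , Φ₃ , p , (Φ₁ , Φ₂ , q , c₁ , c₂) , c₃) =
  Φ₁ , Φ₂ ++ Φ₃ , ↭-trans (↭-sym (↭.++-assoc Φ₁ Φ₂ Φ₃)) (↭-trans (↭.++⁺ʳ Φ₃ q) p) ,
  c₁ , (Φ₂ , Φ₃ , ↭-refl , c₂ , c₃)
heatAx-forward (ax-nil {P}) Φ (Φ₁ , Φ₂ , p , c₁ , _) =
  Covered-↭ (skel P) p (Covered-weaken (skel P) Φ₁ Φ₂ c₁)
heatAx-forward ax-rep Φ c = [] , Φ , ↭-refl , c , c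
heatAx-forward ax-nu-nil Φ c = tt
heatAx-forward (ax-nu-par {P = P} {Q}) Φ (Ψ₁ , Ψ₂ , p , c₁ , c₂) with map-↭-++ shiftF Φ Ψ₁ Ψ₂ p
... | Φ₁ , Φ₂ , q , refl , refl =
  Φ₁ , Φ₂ , q , c₁ ,
  Covered-unrename shift2-injective (skel Q) Φ₂ (subst (λ E → Covered E (map shiftF Φ₂)) (skel-wk2P Q) c₂)
heatAx-forward (ax-nu-nu {P = P}) Φ c =
  subst₂ Covered (sym (skel-swap P)) (swap2-shifted Φ) (Covered-rename swap2-injective (skel P) _ c)
heatAx-forward (ax-nu-asm {φ = φ} {P}) Φ c = subst (Covered (skel P)) (sym (atoms-wk2F φ Φ)) c
heatAx-forward ax-asm-1 Φ c = c
heatAx-forward (ax-ast-1 {P}) Φ (Ψ , p , c) = Covered-↭ (skel P) p c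
heatAx-forward (ax-asm-asm {φ₁} {φ₂} {P}) Φ c = Covered-↭ (skel P) (↭.shifts (atoms φ₂) (atoms φ₁)) c
heatAx-forward (ax-ast-ast {φ₁} {φ₂} {P}) = ast-comm φ₁ φ₂ (skel P)
heatAx-forward (ax-ast-⊗ {φ₁} {φ₂}) Φ (Ψ , p , c) =
  atoms φ₂ ++ Ψ , ↭-trans (↭-sym (↭.++-assoc (atoms φ₁) (atoms φ₂) Ψ)) p , (Ψ , ↭-refl , c)
heatAx-forward (ax-asm-⊗ {φ₁} {φ₂} {P}) Φ c =
  Covered-↭ (skel P) (↭-trans (↭.++-assoc (atoms φ₁) (atoms φ₂) Φ) (↭.shifts (atoms φ₁) (atoms φ₂))) c
heatAx-forward (ax-nu-ty _ _ _) Φ c = c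

heatAx-backward : ∀ {P Q} → HeatAx P Q → Q ⊑ P
heatAx-backward (ax-comm {P} {Q}) = par-comm {skel Q} {skel P}
heatAx-backward ax-assoc Φ (Φ₁ , Φ₂₃ , p , c₁ , (Φ₂ , Φ₃ , q , c₂ , c₃)) =
  Φ₁ ++ Φ₂ , Φ₃ , ↭-trans (↭.++-assoc Φ₁ Φ₂ Φ₃) (↭-trans (↭.++⁺ˡ Φ₁ q) p) ,
  (Φ₁ , Φ₂ , ↭-refl , c₁ , c₂) , c₃
heatAx-backward ax-nil Φ c = Φ , [] , ↭.++-identityʳ Φ , c , tt
heatAx-backward ax-rep Φ (_ , _ , _ , _ , c) = c
heatAx-backward ax-nu-nil Φ c = tt
heatAx-backward (ax-nu-par {Q = Q}) Φ (Φ₁ , Φ₂ , p , c₁ , c₂) =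
  map shiftF Φ₁ , map shiftF Φ₂ ,
  ↭-trans (↭-reflexive (sym (map-++ shiftF Φ₁ Φ₂))) (↭.map⁺ shiftF p) , c₁ ,
  subst (λ E → Covered E (map shiftF Φ₂)) (sym (skel-wk2P Q)) (Covered-rename shift2-injective (skel Q) Φ₂ c₂)
heatAx-backward (ax-nu-nu {P = P}) Φ c =
  Covered-unrename swap2-injective (skel P) _ (subst₂ Covered (skel-swap P) (sym (swap2-shifted Φ)) c)
heatAx-backward (ax-nu-asm {φ = φ} {P}) Φ c = subst (Covered (skel P)) (atoms-wk2F φ Φ) c
heatAx-backward ax-asm-1 Φ c = c
heatAx-backward ax-ast-1 Φ c = Φ , ↭-refl , c
heatAx-backward (ax-asm-asm {φ₁} {φ₂} {P}) Φ c = Covered-↭ (skel P) (↭.shifts (atoms φ₁) (atoms φ₂)) c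
heatAx-backward (ax-ast-ast {φ₁} {φ₂} {P}) = ast-comm φ₂ φ₁ (skel P)
heatAx-backward (ax-ast-⊗ {φ₁} {φ₂}) Φ (Ψ₁ , p , (Ψ₂ , q , c)) =
  Ψ₂ , ↭-trans (↭.++-assoc (atoms φ₁) (atoms φ₂) Ψ₂) (↭-trans (↭.++⁺ˡ (atoms φ₁) q) p) , c
heatAx-backward (ax-asm-⊗ {φ₁} {φ₂} {P}) Φ c =
  Covered-↭ (skel P) (↭-trans (↭.shifts (atoms φ₂) (atoms φ₁)) (↭-sym (↭.++-assoc (atoms φ₁) (atoms φ₂) Φ))) c
heatAx-backward (ax-nu-ty _ _ _) Φ c = c

heat-preserves : ∀ {P Q} → P ⇛ Q → P ⊑ Q
heat-preserves h-refl Φ c = c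
heat-preserves (h-trans d e) Φ c = heat-preserves e Φ (heat-preserves d Φ c)
heat-preserves (h-ax a) = heatAx-forward a
heat-preserves (h-xa a) = heatAx-backward a
heat-preserves (h-extr {φ}) Φ (Φ₁ , Φ₂ , p , c₁ , c₂) =
  atoms φ ++ Φ₁ , Φ₂ , ↭-trans (↭.++-assoc (atoms φ) Φ₁ Φ₂) (↭.++⁺ˡ (atoms φ) p) , c₁ , c₂
heat-preserves (h-send d) Φ c = tt
heat-preserves (h-recv d) Φ c = tt
heat-preserves (h-parL d) Φ (Φ₁ , Φ₂ , p , c₁ , c₂) = Φ₁ , Φ₂ , p , heat-preserves d Φ₁ c₁ , c₂
heat-preserves (h-parR d) Φ (Φ₁ , Φ₂ , p , c₁ , c₂) = Φ₁ , Φ₂ , p , c₁ , heat-preserves d Φ₂ c₂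
heat-preserves (h-rep d) Φ c = heat-preserves d [] c
heat-preserves (h-nu d) Φ c = heat-preserves d (map shiftF Φ) c
heat-preserves (h-assume {φ} d) Φ c = heat-preserves d (atoms φ ++ Φ) c
heat-preserves (h-assert d) Φ (Ψ , p , c) = Ψ , p , heat-preserves d Ψ c

resources : Ctx → List Fml
resources ∅ = []
resources (Γ ▸ x ∶ T) = resources Γ
resources (Γ ▹ φ) = resources Γ ++ atoms φ

-- a context without refinement types (the only ones hiding formulae)
NotRef : Ty → Set
NotRef (ref T φ) = ⊥
NotRef _ = ⊤

NoRef : Ctx → Set
NoRef ∅ = ⊤
NoRef (Γ ▸ x ∶ T) = NoRef Γ × NotRef T
NoRef (Γ ▹ φ) = NoRef Γ

ScopedIn : List Fml → List ℕ → Set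
ScopedIn Φ D = ∀ {ψ n} → ψ ∈ Φ → n ∈ fvF ψ → n ∈ D

Scoped : Ctx → Set
Scoped Γ = ScopedIn (resources Γ) (dom Γ)

resources-⧺ : ∀ {A A′} → resources A ≡ resources A′ → ∀ B → resources (A ⧺ B) ≡ resources (A′ ⧺ B)
resources-⧺ e ∅ = e
resources-⧺ e (B ▸ x ∶ T) = resources-⧺ e B
resources-⧺ e (B ▹ φ) = cong (_++ atoms φ) (resources-⧺ e B)

dom-⧺ : ∀ {A A′} → dom A ≡ dom A′ → ∀ B → dom (A ⧺ B) ≡ dom (A′ ⧺ B)
dom-⧺ e ∅ = e
dom-⧺ e (B ▸ x ∶ T) = cong (x ∷_) (dom-⧺ e B)
dom-⧺ e (B ▹ φ) = dom-⧺ e B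

NoRef-⧺ : ∀ {A A′} → (NoRef A → NoRef A′) → ∀ B → NoRef (A ⧺ B) → NoRef (A′ ⧺ B)
NoRef-⧺ f ∅ nr = f nr
NoRef-⧺ f (B ▸ x ∶ T) (nr , t) = NoRef-⧺ f B nr , t
NoRef-⧺ f (B ▹ φ) nr = NoRef-⧺ f B nr

NoRef-⧺ˡ : ∀ A B → NoRef (A ⧺ B) → NoRef A
NoRef-⧺ˡ A ∅ nr = nr
NoRef-⧺ˡ A (B ▸ x ∶ T) (nr , _) = NoRef-⧺ˡ A B nr
NoRef-⧺ˡ A (B ▹ φ) nr = NoRef-⧺ˡ A B nr

Un-⧺ : ∀ A B → Un (A ⧺ B) → Un A × Un B
Un-⧺ A ∅ u = u , un-∅
Un-⧺ A (B ▸ x ∶ T) (un-▸ u t) with Un-⧺ A B u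
... | uA , uB = uA , un-▸ uB t
Un-⧺ A (B ▹ φ) ()

Un-resources : ∀ {Γ} → Un Γ → resources Γ ≡ []
Un-resources un-∅ = refl
Un-resources (un-▸ u t) = Un-resources u

resources-⧺-Un : ∀ A {B} → Un B → resources (A ⧺ B) ≡ resources A
resources-⧺-Un A un-∅ = refl
resources-⧺-Un A (un-▸ u t) = resources-⧺-Un A u

UnT-NotRef : ∀ {T} → UnT T → NotRef T
UnT-NotRef un-unit = tt
UnT-NotRef un-end = tt
UnT-NotRef un-sess = tt

Un-NoRef : ∀ {Γ} → Un Γ → NoRef Γ
Un-NoRef un-∅ = tt
Un-NoRef (un-▸ u t) = Un-NoRef u , UnT-NotRef t

Dual-NotRef : ∀ {T T′} → Dual T T′ → NotRef T × NotRef T′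
Dual-NotRef (d-in d) = tt , tt
Dual-NotRef (d-out d) = tt , tt
Dual-NotRef d-end = tt , tt
Dual-NotRef (d-mu d) = tt , tt
Dual-NotRef d-var = tt , tt

atoms-fv : ∀ φ {ψ n} → ψ ∈ atoms φ → n ∈ fvF ψ → n ∈ fvF φ
atoms-fv (atom A vs) (here refl) m = m
atoms-fv (φ ⊗ φ′) p m with ∈-++⁻ (atoms φ) p
... | inj₁ q = ∈-++⁺ˡ (atoms-fv φ q m)
... | inj₂ q = ∈-++⁺ʳ (fvF φ) (atoms-fv φ′ q m)

Scoped-▹ : ∀ Γ φ → Scoped Γ → (∀ {n} → n ∈ fvF φ → n ∈ dom Γ) → Scoped (Γ ▹ φ)
Scoped-▹ Γ φ sc wf p m with ∈-++⁻ (resources Γ) p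
... | inj₁ q = sc q m
... | inj₂ q = wf (atoms-fv φ q m)

split-resources : ∀ {Γ Γ₁ Γ₂} → Split Γ Γ₁ Γ₂ → resources Γ ↭ resources Γ₁ ++ resources Γ₂
split-resources s-∅ = ↭-refl
split-resources (s-linL s _) = split-resources s
split-resources (s-linR s _) = split-resources s
split-resources (s-un s _) = split-resources s
split-resources {Γ ▹ φ} {Γ₁ ▹ .φ} {Γ₂} (s-fmL s _) =
  ↭-trans (↭.++⁺ʳ (atoms φ) (split-resources s))
  (↭-trans (↭.++-assoc (resources Γ₁) (resources Γ₂) (atoms φ))
  (↭-trans (↭.++⁺ˡ (resources Γ₁) (↭.++-comm (resources Γ₂) (atoms φ)))
           (↭-sym (↭.++-assoc (resources Γ₁) (atoms φ) (resources Γ₂)))))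
split-resources {Γ ▹ φ} {Γ₁} {Γ₂ ▹ .φ} (s-fmR s _) =
  ↭-trans (↭.++⁺ʳ (atoms φ) (split-resources s)) (↭.++-assoc (resources Γ₁) (resources Γ₂) (atoms φ))

-- only session and unrestricted types can be split
split-NoRef : ∀ {Γ Γ₁ Γ₂} → Split Γ Γ₁ Γ₂ → NoRef Γ × NoRef Γ₁ × NoRef Γ₂
split-NoRef s-∅ = tt , tt , tt
split-NoRef (s-linL s _) with split-NoRef s
... | nr , nr₁ , nr₂ = (nr , tt) , (nr₁ , tt) , nr₂
split-NoRef (s-linR s _) with split-NoRef s
... | nr , nr₁ , nr₂ = (nr , tt) , nr₁ , (nr₂ , tt)
split-NoRef (s-un s t) with split-NoRef s
... | nr , nr₁ , nr₂ = (nr , UnT-NotRef t) , (nr₁ , UnT-NotRef t) , (nr₂ , UnT-NotRef t)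
split-NoRef (s-fmL s _) = split-NoRef s
split-NoRef (s-fmR s _) = split-NoRef s

split-dom₁ : ∀ {Γ Γ₁ Γ₂} → Split Γ Γ₁ Γ₂ → ∀ {n} → n ∈ dom Γ₁ → n ∈ dom Γ
split-dom₁ s-∅ m = m
split-dom₁ (s-linL s _) (here e) = here e
split-dom₁ (s-linL s _) (there m) = there (split-dom₁ s m)
split-dom₁ (s-linR s _) m = there (split-dom₁ s m)
split-dom₁ (s-un s _) (here e) = here e
split-dom₁ (s-un s _) (there m) = there (split-dom₁ s m)
split-dom₁ (s-fmL s _) m = split-dom₁ s m
split-dom₁ (s-fmR s _) m = split-dom₁ s m

split-dom₂ : ∀ {Γ Γ₁ Γ₂} → Split Γ Γ₁ Γ₂ → ∀ {n} → n ∈ dom Γ₂ → n ∈ dom Γ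
split-dom₂ s-∅ m = m
split-dom₂ (s-linR s _) (here e) = here e
split-dom₂ (s-linR s _) (there m) = there (split-dom₂ s m)
split-dom₂ (s-linL s _) m = there (split-dom₂ s m)
split-dom₂ (s-un s _) (here e) = here e
split-dom₂ (s-un s _) (there m) = there (split-dom₂ s m)
split-dom₂ (s-fmL s _) m = split-dom₂ s m
split-dom₂ (s-fmR s _) m = split-dom₂ s m

-- the well-formedness premises of a split scope the formulae of all three contexts
split-Scoped : ∀ {Γ Γ₁ Γ₂} → Split Γ Γ₁ Γ₂ → Scoped Γ × Scoped Γ₁ × Scoped Γ₂
split-Scoped {Γ} {Γ₁} {Γ₂} s = whole , parts s
  where
  parts : ∀ {Γ Γ₁ Γ₂} → Split Γ Γ₁ Γ₂ → Scoped Γ₁ × Scoped Γ₂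
  parts s-∅ = (λ ()) , (λ ())
  parts (s-linL s _) with parts s
  ... | sc₁ , sc₂ = (λ p m → there (sc₁ p m)) , sc₂
  parts (s-linR s _) with parts s
  ... | sc₁ , sc₂ = sc₁ , (λ p m → there (sc₂ p m))
  parts (s-un s _) with parts s
  ... | sc₁ , sc₂ = (λ p m → there (sc₁ p m)) , (λ p m → there (sc₂ p m))
  parts {Γ₁ = Γ₁ ▹ φ} (s-fmL s wf) = Scoped-▹ Γ₁ φ (proj₁ (parts s)) (proj₂ wf) , proj₂ (parts s)
  parts {Γ₂ = Γ₂ ▹ φ} (s-fmR s wf) = proj₁ (parts s) , Scoped-▹ Γ₂ φ (proj₂ (parts s)) (proj₂ wf)
  whole : Scoped Γ
  whole p m with ∈-++⁻ (resources Γ₁) (↭.∈-resp-↭ (split-resources s) p)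
  ... | inj₁ q = split-dom₁ s (proj₁ (parts s) q m)
  ... | inj₂ q = split-dom₂ s (proj₂ (parts s) q m)

formula-resources : ∀ {Γ φ} → Γ ⊢F φ → resources Γ ↭ atoms φ
formula-resources (f-one _ u) = ↭-reflexive (Un-resources u)
formula-resources (f-ax {Γ₁} {Γ₂} {φ} _ u) with Un-⧺ Γ₁ Γ₂ u
... | u₁ , u₂ =
  ↭-reflexive (trans (resources-⧺-Un (Γ₁ ▹ φ) u₂) (cong (_++ atoms φ) (Un-resources u₁)))
formula-resources (f-⊗ s d₁ d₂) =
  ↭-trans (split-resources s) (↭.++⁺ (formula-resources d₁) (formula-resources d₂))

Opened : ℕ → ℕ → ℕ → Set
Opened x y n = (n ≡ x) ⊎ (n ≡ y)

open₂ : ℕ → ℕ → Act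
open₂ x y = subVar (σ₀Var (fr x)) ∘ subVar (σ₀Var (fr y))

close : ℕ → ℕ → Act
close x y (bd i) = bd (suc (suc i))
close x y (fr n) with n ≟ y | n ≟ x
... | yes _ | _ = bd 0
... | no _ | yes _ = bd 1
... | no _ | no _ = fr n

close-fresh : ∀ x y n → ¬ Opened x y n → close x y (fr n) ≡ fr n
close-fresh x y n ok with n ≟ y | n ≟ x
... | yes n≡y | _ = ⊥-elim (ok (inj₂ n≡y))
... | no _ | yes n≡x = ⊥-elim (ok (inj₁ n≡x))
... | no _ | no _ = refl

open-close : ∀ x y v → open₂ x y (close x y v) ≡ v
open-close x y (bd i) = refl
open-close x y (fr n) with n ≟ y | n ≟ x
... | yes n≡y | _ = cong fr (sym n≡y)
... | no _ | yes n≡x = cong fr (sym n≡x)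
... | no _ | no _ = refl

close-injective : ∀ x y → Injective _≡_ _≡_ (close x y)
close-injective x y {v} {w} e = trans (sym (open-close x y v)) (trans (cong (open₂ x y) e) (open-close x y w))

close-open : ∀ {x y} → x ≢ y → Agree (Opened x y) (close x y ∘ open₂ x y) id
close-open {x} {y} x≢y (bd zero) _ with y ≟ y
... | yes _ = refl
... | no y≢y = ⊥-elim (y≢y refl)
close-open {x} {y} x≢y (bd (suc zero)) _ with x ≟ y | x ≟ x
... | yes x≡y | _ = ⊥-elim (x≢y x≡y)
... | no _ | yes _ = refl
... | no _ | no x≢x = ⊥-elim (x≢x refl)
close-open x≢y (bd (suc (suc i))) _ = refl
close-open {x} {y} x≢y (fr n) ok = close-fresh x y n ok

close-shift2 : ∀ {x y} → Agree (Opened x y) (close x y) shift2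
close-shift2 (bd i) _ = refl
close-shift2 {x} {y} (fr n) ok = close-fresh x y n ok

skel-open2 : ∀ P x y → skel (open2 P x y) ≡ mapSkel (open₂ x y) (skel P)
skel-open2 P x y = begin
  skel (subP σx (subP σy P))               ≡⟨ skel-subP (λ _ → refl) (subP σy P) ⟩
  mapSkel (subVar σx) (skel (subP σy P))   ≡⟨ cong (mapSkel (subVar σx)) (skel-subP (λ _ → refl) P) ⟩
  mapSkel (subVar σx) (mapSkel (subVar σy) (skel P)) ≡⟨ mapSkel-fuse (λ _ → refl) (skel P) ⟩
  mapSkel (open₂ x y) (skel P)             ∎
  where
  open ≡-Reasoning
  σx σy : ℕ → Var
  σx = σ₀Var (fr x)
  σy = σ₀Var (fr y)

Covered-close : ∀ {x y} P Φ → x ≢ y → x ∉ fvP P → y ∉ fvP P →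
                (∀ {ψ} → ψ ∈ Φ → Fresh (Opened x y) (fvF ψ)) →
                Covered (skel (open2 P x y)) Φ → Covered (skel P) (map shiftF Φ)
Covered-close {x} {y} P Φ x≢y x∉P y∉P Φ-fresh c =
  subst₂ Covered reclosed Φ-shifted
    (Covered-rename (close-injective x y) (mapSkel (open₂ x y) (skel P)) Φ
      (subst (λ E → Covered E Φ) (skel-open2 P x y) c))
  where
  P-fresh : Fresh (Opened x y) (fvS (skel P))
  P-fresh m (inj₁ refl) = x∉P (fvS-skel P m)
  P-fresh m (inj₂ refl) = y∉P (fvS-skel P m)
  reclosed : mapSkel (close x y) (mapSkel (open₂ x y) (skel P)) ≡ skel P
  reclosed = trans (mapSkel-fuse (λ _ → refl) (skel P)) (mapSkel-fixes (close-open x≢y) (skel P) P-fresh)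
  Φ-shifted : map (mapFml (close x y)) Φ ≡ map shiftF Φ
  Φ-shifted = map-cong-local (tabulate (λ {ψ} p → mapFml-agree close-shift2 ψ (Φ-fresh p)))

-- Invariants along the derivation: the context has no refinement types
-- (splits and dual session types never introduce them), and its formulae
-- only mention its own names (needed to re-close ν-binders).
typed-covered : ∀ {Γ P} → Γ ⊢P P → NoRef Γ → Scoped Γ → Covered (skel P) (resources Γ)
typed-covered (t-nil _ _) _ _ = tt
typed-covered (t-par {Γ₁ = Γ₁} {Γ₂ = Γ₂} s d₁ d₂) _ _ with split-NoRef s | split-Scoped s
... | _ , nr₁ , nr₂ | _ , sc₁ , sc₂ =
  resources Γ₁ , resources Γ₂ , ↭-sym (split-resources s) ,
  typed-covered d₁ nr₁ sc₁ , typed-covered d₂ nr₂ sc₂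
typed-covered {Γ} (t-nu {P = P} x y x≢y x∉Γ y∉Γ x∉P y∉P _ dual d) nr sc =
  Covered-close P (resources Γ) x≢y x∉P y∉P Γ-fresh
    (typed-covered d ((nr , proj₁ (Dual-NotRef dual)) , proj₂ (Dual-NotRef dual))
                     (λ p m → there (there (sc p m))))
  where
  Γ-fresh : ∀ {ψ} → ψ ∈ resources Γ → Fresh (Opened x y) (fvF ψ)
  Γ-fresh p m (inj₁ refl) = x∉Γ (sc p m)
  Γ-fresh p m (inj₂ refl) = y∉Γ (sc p m)
typed-covered (t-rep {P = P} u d) nr sc = subst (Covered (skel P)) (Un-resources u) (typed-covered d nr sc)
typed-covered (t-out _ _ _ _ _ _) _ _ = tt
typed-covered (t-in _ _ _ _ _ _ _ _) _ _ = tt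
typed-covered {Γ₁} (t-assume {Γ} {Γ₂ = Γ₂} {φ} {P} s dφ d) _ _ with split-NoRef s | split-Scoped s
... | nr , _ , _ | sc , _ , _ = Covered-↭ (skel P) redistribute (typed-covered d nr sc)
  where
  redistribute : resources Γ ↭ atoms φ ++ resources Γ₁
  redistribute = ↭-trans (split-resources s)
                 (↭-trans (↭.++⁺ˡ (resources Γ₁) (formula-resources dφ)) (↭.++-comm (resources Γ₁) (atoms φ)))
typed-covered (t-assert {Γ₂ = Γ₂} s dφ d) _ _ with split-NoRef s | split-Scoped s
... | _ , _ , nr₂ | _ , _ , sc₂ =
  resources Γ₂ , ↭-sym (↭-trans (split-resources s) (↭.++⁺ʳ (resources Γ₂) (formula-resources dφ))) ,
  typed-covered d nr₂ sc₂
typed-covered {Γ ▹ .𝟏} (t-one {P = P} d) nr sc =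
  Covered-weaken (skel P) (resources Γ) [] (typed-covered d nr (λ p → sc (∈-++⁺ˡ p)))
typed-covered (t-⊗ {Γ₁} {Γ₂} {φ₁} {φ₂} {P} d) nr sc =
  subst (Covered (skel P)) same-resources
    (typed-covered d (NoRef-⧺ id Γ₂ nr) (subst₂ ScopedIn (sym same-resources) (sym (dom-⧺ refl Γ₂)) sc))
  where
  same-resources : resources ((Γ₁ ▹ φ₁ ▹ φ₂) ⧺ Γ₂) ≡ resources ((Γ₁ ▹ (φ₁ ⊗ φ₂)) ⧺ Γ₂)
  same-resources = resources-⧺ (++-assoc (resources Γ₁) (atoms φ₁) (atoms φ₂)) Γ₂
typed-covered (t-ref {Γ₁} {Γ₂} {x} {T} {φ} d) nr sc =
  ⊥-elim (proj₂ (NoRef-⧺ˡ (Γ₁ ▸ x ∶ ref T φ) Γ₂ nr))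

unrestricted-covered : ∀ {Γ P} → Un Γ → Γ ⊢P P → Covered (skel P) []
unrestricted-covered {Γ} {P} u d =
  subst (Covered (skel P)) (Un-resources u) (typed-covered d (Un-NoRef u) no-formulae)
  where
  no-formulae : Scoped Γ
  no-formulae p rewrite Un-resources u with p
  ... | ()

atomsOf : List Fml → List Fml
atomsOf [] = []
atomsOf (φ ∷ Φ) = atoms φ ++ atomsOf Φ

atomsOf-atomic : ∀ {As} → All IsAtom As → atomsOf As ≡ As
atomsOf-atomic [] = refl
atomsOf-atomic (is-atom A vs ∷ as) = cong (atom A vs ∷_) (atomsOf-atomic as)

nus-covered : ∀ Ts X → Covered (skel (nus Ts X)) [] → Covered (skel X) []
nus-covered [] X c = c
nus-covered (T ∷ Ts) X c = nus-covered Ts X c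

assumes-covered : ∀ As Y Φ → Covered (skel (assumes As Y)) Φ → Covered (skel Y) (atomsOf As ++ Φ)
assumes-covered [] Y Φ c = c
assumes-covered (A ∷ As) Y Φ c =
  Covered-↭ (skel Y) (↭-trans (↭.shifts (atomsOf As) (atoms A)) (↭-sym (↭.++-assoc (atoms A) (atomsOf As) Φ)))
    (assumes-covered As Y (atoms A ++ Φ) c)

assert-covered : ∀ {B R Φ} → IsAtom B → Covered (skel (assert B R)) Φ → B ∈ Φ
assert-covered (is-atom A vs) (Ψ , p , _) = ↭.∈-resp-↭ p (here refl)

pars-covered : ∀ P Ps Φ {B R} → Covered (skel (pars P Ps)) Φ → assert B R ∈ (P ∷ Ps) → IsAtom B → B ∈ Φ
pars-covered P [] Φ {R = R} c (here refl) atomic = assert-covered {R = R} atomic c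
pars-covered P (Q ∷ Qs) Φ {R = R} (Φ₁ , Φ₂ , p , c₁ , c₂) (here refl) atomic =
  ↭.∈-resp-↭ p (∈-++⁺ˡ (assert-covered {R = R} atomic c₁))
pars-covered P (Q ∷ Qs) Φ (Φ₁ , Φ₂ , p , c₁ , c₂) (there m) atomic =
  ↭.∈-resp-↭ p (∈-++⁺ʳ Φ₁ (pars-covered Q Qs Φ₂ c₂ m atomic))

theorem6 : (Γ : Ctx) (P : Proc) → ValidCtx Γ → ValidP P →
           Γ ⊢P P → Un Γ → Safe P
theorem6 Γ P _ _ d u Ts As P₀ Ps heated atomic _ B R asserted B-atomic =
  subst (B ∈_) (trans (++-identityʳ (atomsOf As)) (atomsOf-atomic atomic)) B-assumed
  where
  body-covered : Covered (skel (pars P₀ Ps)) (atomsOf As ++ [])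
  body-covered = assumes-covered As (pars P₀ Ps) []
                   (nus-covered Ts (assumes As (pars P₀ Ps))
                     (heat-preserves heated [] (unrestricted-covered u d)))
  B-assumed : B ∈ atomsOf As ++ []
  B-assumed = pars-covered P₀ Ps _ body-covered asserted B-atomic
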